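{- $\mathrm{VD}_{\mathrm{undir}}(ae) \subseteq \mathrm{para}\text{ - }\mathrm{AC}^0$; that is, for every first-order sentence $\phi=\forall x\exists y\,\psi(x,y)$ over $\{\sim\}$ with $\psi$ quantifier-free, the problem $\mathrm{vd}_{\mathrm{undir}}(\phi)$ lies in $\mathrm{para}\text{ - }\mathrm{AC}^0$.
   Context: An undirected graph is a finite structure $G=(V,\sim)$, $V$ nonempty, with $\sim$ a symmetric binary relation (self-loops allowed). For $S\subseteq V$, $G\setminus S$ is the induced subgraph on $V\setminus S$. Formulas may use equality. $\mathrm{vd}_{\mathrm{undir}}(\phi)$ is the parameterized problem: given an undirected graph $G$ and $k\in\mathbb N$ (parameter $k$), decide whether some $S\subseteq V$ with $|S|\le k$ satisfies $G\setminus S\models\phi$. $\mathrm{para}\text{ - }\mathrm{AC}^0$ is the class of parameterized problems decidable by families $(C_{n,k})$ of unbounded fan-in Boolean circuits of constant depth and size $f(k)\cdot n^{O(1)}$ for a computable $f$. -}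

module Defs where

open import Data.Nat using (ℕ; zero; suc; _+_; _*_; _^_; _≤_; _⊔_)
open import Data.Bool using (Bool; true; false; not; _∧_; _∨_)
open import Data.Fin using (Fin; inject₁; fromℕ)
open import Data.Fin.Subset using (Subset; _∈_; _∉_; ∣_∣)
import Data.Fin as F
open import Data.Vec using (Vec; []; _∷ʳ_; lookup)
open import Data.List using (List)
import Data.List as L
import Data.Bool.ListAction as BL
open import Data.Product using (Σ; ∃; _×_; _,_)
open import Relation.Nullary using (does)
open import Relation.Binary.PropositionalEquality using (_≡_)
open import Function.Bundles using (_⇔_)

-- Undirected graphs (self-loops allowed) on vertex set Fin n

record Graph (n : ℕ) : Set where
  field
    adj : Fin n → Fin n → Bool
    sym : ∀ i j → adj i j ≡ adj j i
open Graph public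

data Var : Set where
  vx vy : Var

data QF : Set where
  ⊤f ⊥f  : QF
  adjf   : Var → Var → QF
  eqf    : Var → Var → QF
  ¬f     : QF → QF
  _∧f_   : QF → QF → QF
  _∨f_   : QF → QF → QF

evalQF : ∀ {n} → Graph n → QF → Fin n → Fin n → Bool
evalQF G φ a b = go φ
  where
  val : Var → _
  val vx = a
  val vy = b
  go : QF → Bool
  go ⊤f = true
  go ⊥f = false
  go (adjf u v) = adj G (val u) (val v)
  go (eqf u v) = does (val u F.≟ val v)
  go (¬f ψ) = not (go ψ)
  go (ψ ∧f χ) = go ψ ∧ go χ
  go (ψ ∨f χ) = go ψ ∨ go χ

-- G ∖ S ⊨ ∀x ∃y ψ(x,y), where G ∖ S is the induced subgraph on the
-- complement of S (which must be nonempty to be a graph); the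
-- quantifiers range over the vertices outside S and ∼ is the restriction.
DelSat : ∀ {n} → Graph n → Subset n → QF → Set
DelSat {n} G S ψ =
  (∃ λ (z : Fin n) → z ∉ S) ×
  (∀ (x : Fin n) → x ∉ S → ∃ λ (y : Fin n) → y ∉ S × evalQF G ψ x y ≡ true)

vd-ae : QF → (n : ℕ) → Graph n → ℕ → Set
vd-ae ψ n G k = ∃ λ (S : Subset n) → ∣ S ∣ ≤ k × DelSat G S ψ

-- Boolean circuits with unbounded fan-in (as DAGs), inputs indexed by I.
-- A gate may only read input bits and earlier gates (Fin g).

data Gate (I : Set) (g : ℕ) : Set where
  input  : I → Gate I g
  const  : Bool → Gate I g
  notg   : Fin g → Gate I g
  andg   : List (Fin g) → Gate I g
  org    : List (Fin g) → Gate I g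

data Circuit (I : Set) : ℕ → Set where
  []  : Circuit I zero
  _▷_ : ∀ {g} → Circuit I g → Gate I g → Circuit I (suc g)

gateVal : ∀ {I g} → (I → Bool) → Vec Bool g → Gate I g → Bool
gateVal w vs (input i) = w i
gateVal w vs (const b) = b
gateVal w vs (notg i) = not (lookup vs i)
gateVal w vs (andg is) = BL.all (lookup vs) is
gateVal w vs (org is) = BL.any (lookup vs) is

evalAll : ∀ {I g} → Circuit I g → (I → Bool) → Vec Bool g
evalAll [] w = []
evalAll (C ▷ γ) w = let vs = evalAll C w in vs ∷ʳ gateVal w vs γ

output : ∀ {I s} → Circuit I (suc s) → (I → Bool) → Bool
output {s = s} C w = lookup (evalAll C w) (fromℕ s)

gateDepth : ∀ {I g} → Vec ℕ g → Gate I g → ℕ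
gateDepth ds (input i) = 0
gateDepth ds (const b) = 0
gateDepth ds (notg i) = suc (lookup ds i)
gateDepth ds (andg is) = suc (L.foldr _⊔_ 0 (L.map (lookup ds) is))
gateDepth ds (org is) = suc (L.foldr _⊔_ 0 (L.map (lookup ds) is))

depths : ∀ {I g} → Circuit I g → Vec ℕ g
depths [] = []
depths (C ▷ γ) = let ds = depths C in ds ∷ʳ gateDepth ds γ

depth : ∀ {I g} → Circuit I g → ℕ
depth C = Data.Vec.foldr _ _⊔_ 0 (depths C)
  where import Data.Vec

-- The circuit C n k receives the adjacency matrix of an n-vertex graph
-- (one input bit per pair (i , j)); its size (number of gates) is
-- bounded by f(k)·(n+1)^c and its depth by a constant d.  Every Agda
-- function ℕ → ℕ is computable.

ParaAC0 : ((n : ℕ) → Graph n → ℕ → Set) → Set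
ParaAC0 Q =
  Σ (ℕ → ℕ) λ f → Σ ℕ λ c → Σ ℕ λ d →
  Σ ((n k : ℕ) → Σ ℕ λ s → Circuit (Fin n × Fin n) (suc s)) λ C →
    (∀ n k → let (s , Cnk) = C n k in
       (suc s ≤ f k * (suc n) ^ c) × (depth Cnk ≤ d)) ×
    (∀ n k (G : Graph n) → let (s , Cnk) = C n k in
       (output Cnk (λ { (i , j) → adj G i j }) ≡ true) ⇔ Q n G k)

-- Write x ↝ y for ψ(x, y).  At distinct x, y the value of ψ(x, y) depends only on the loops at
-- x and y and on the edge x ∼ y.  Hence, off closed ↝-walks of length 2 or 4 ("short cycles"),
-- every step x ↝ y flips the loop bit and orients its edge, and a path x ↝ y ↝ z ↝ u can be
-- shortcut to x ↝ u.  It follows that every vertex surviving a solution S lies within two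
-- ↝-steps of a short cycle (otherwise two steps inside G ∖ S would strictly shrink its set of
-- stuck successors), while the vertices near short cycles are a solution by themselves.  So
-- (G, k) is a yes-instance iff some vertex is near a short cycle and at most k vertices are not.
-- Nearness is a fixed first-order property; "more than k" is witnessed by k binary digit
-- positions that separate k + 1 vertices, at fan-in (lg n)^k ≤ k^k·2^(lg n) = O_k(n).
-- Constant-depth formulas of such fan-in unfold into circuits of size f(k)·n^O(1).

module Submission where

open import Defs renaming (sym to adj-sym)

open import Data.Bool as Bool using (Bool; true; false; not; _∧_; _∨_; T)
open import Data.Bool.ListAction using (and; or)
open import Data.Bool.Properties using (T-≡; ¬-not; not-¬; not-involutive; ∧-identityʳ; ∨-identityʳ)
open import Data.Empty using (⊥; ⊥-elim)
open import Data.Fin as Fin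
  using (Fin; zero; suc; toℕ; fromℕ; inject₁; inject≤; finToFun; funToFin; combine)
open import Data.Fin.Properties using (any?; ¬∀⟶∃¬; funToFin-finToFin; inject≤-injective; toℕ<n)
import Data.Fin.Properties as Fin
open import Data.Fin.Subset using (Subset; inside; outside; _⊆_; _⊂_; _-_; ∣_∣)
  renaming (_∈_ to _∈ₛ_; _∉_ to _∉ₛ_)
open import Data.Fin.Subset.Properties using (_∈?_; p⊆q⇒∣p∣≤∣q∣; x∈p⇒∣p-x∣<∣p∣; x∈p∧x≢y⇒x∈p-y)
open import Data.Fin.Subset.Induction using (⊂-wellFounded)
open import Data.List as List
  using (List; []; _∷_; map; length; allFin; filter; take; cartesianProductWith)
open import Data.List.Properties
  using (length-map; length-++; length-filter; length-tabulate; length-take; ≡-dec; ∷-injective)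
open import Data.List.Membership.Propositional using (_∈_; find; lose)
open import Data.List.Membership.Propositional.Properties
  using (∈-allFin; ∈-filter⁺; ∈-filter⁻; ∈-cartesianProductWith⁺; ∈-cartesianProductWith⁻)
open import Data.List.Relation.Unary.All as All using (All; []; _∷_)
import Data.List.Relation.Unary.All.Properties as All
open import Data.List.Relation.Unary.Any as Any using (Any; here; there)
import Data.List.Relation.Unary.Any.Properties as Any
open import Data.List.Relation.Unary.AllPairs as AllPairs using (AllPairs; []; _∷_)
import Data.List.Relation.Unary.AllPairs.Properties as AllPairs
open import Data.List.Relation.Unary.Unique.Propositional using (Unique)
import Data.List.Relation.Unary.Unique.Propositional.Properties as Unique
open import Data.Nat using (ℕ; zero; suc; _+_; _*_; _^_; _≤_; _⊔_; _⊓_; z≤n; s≤s; _≤?_)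
open import Data.Nat.Properties
open import Data.Nat.DivMod using (_/_; _%_; m≡m%n+[m/n]*n; m%n<n; m/n*n≤m)
open import Data.Product as Product using (Σ; ∃; _×_; _,_; proj₁; proj₂)
open import Data.Product.Function.NonDependent.Propositional using (_×-⇔_)
open import Data.Sum using (_⊎_; inj₁; inj₂; [_,_]′)
open import Data.Sum.Function.Propositional using (_⊎-⇔_)
open import Data.Vec as Vec using (Vec; []; _∷_; _∷ʳ_; lookup; tabulate; here; there)
open import Data.Vec.Properties using (lookup∘tabulate; lookup⇒[]=; []=⇒lookup)
open import Function using (_∘_; _on_; id)
open import Function.Bundles using (_⇔_; mk⇔; module Equivalence)
open import Function.Construct.Composition using (_⇔-∘_)
open import Function.Construct.Identity using (⇔-id)
open import Function.Construct.Symmetry using (⇔-sym)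
open import Function.Related.TypeIsomorphisms using (→-cong-⇔)
open import Induction.InfiniteDescent using (descent∧wf⇒empty)
import Relation.Binary.Construct.On as On
open import Relation.Binary.Definitions using (DecidableEquality)
open import Relation.Binary.PropositionalEquality
  using (_≡_; _≢_; refl; sym; trans; cong; cong₂; subst; subst₂; module ≡-Reasoning)
open import Relation.Nullary using (¬_; Dec; yes; no; does; ¬?; _×-dec_; _⊎-dec_)
open import Relation.Nullary.Decidable using (dec-true; dec-false; decidable-stable)

open Equivalence using (to; from)

private
  variable
    A B C : Set
    I : Set
    n m g k D F : ℕ

∃-⇔ : ∀ {P Q : A → Set} → (∀ {x} → P x ⇔ Q x) → ∃ P ⇔ ∃ Q
∃-⇔ P⇔Q = mk⇔ (Product.map₂ (to P⇔Q)) (Product.map₂ (from P⇔Q))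

¬-⇔ : A ⇔ B → (¬ A) ⇔ (¬ B)
¬-⇔ A⇔B = →-cong-⇔ A⇔B (⇔-id ⊥)

data Formula (I : Set) : Set where
  var     : I → Formula I
  lit     : Bool → Formula I
  neg     : Formula I → Formula I
  AND OR  : List (Formula I) → Formula I

module _ (w : I → Bool) where
  mutual
    eval : Formula I → Bool
    eval (var i)  = w i
    eval (lit b)  = b
    eval (neg φ)  = not (eval φ)
    eval (AND φs) = and (evals φs)
    eval (OR φs)  = or (evals φs)

    evals : List (Formula I) → List Bool
    evals []       = []
    evals (φ ∷ φs) = eval φ ∷ evals φs

  evals-map : ∀ φs → evals φs ≡ map eval φs
  evals-map []       = refl
  evals-map (φ ∷ φs) = cong (eval φ ∷_) (evals-map φs)

-- A record rather than T (eval w φ), so that φ can be inferred from w ⊨ φ.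
infix 4 _⊨_
record _⊨_ (w : I → Bool) (φ : Formula I) : Set where
  constructor sat
  field truth : T (eval w φ)
open _⊨_

⊨⇔T : ∀ {w : I → Bool} {φ} → w ⊨ φ ⇔ T (eval w φ)
⊨⇔T = mk⇔ truth sat

mutual
  depthᶠ : Formula I → ℕ
  depthᶠ (var _)  = 0
  depthᶠ (lit _)  = 0
  depthᶠ (neg φ)  = suc (depthᶠ φ)
  depthᶠ (AND φs) = suc (maxDepth φs)
  depthᶠ (OR φs)  = suc (maxDepth φs)

  maxDepth : List (Formula I) → ℕ
  maxDepth []       = 0
  maxDepth (φ ∷ φs) = depthᶠ φ ⊔ maxDepth φs

mutual
  fanIn : Formula I → ℕ
  fanIn (var _)  = 0
  fanIn (lit _)  = 0
  fanIn (neg φ)  = 1 ⊔ fanIn φ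
  fanIn (AND φs) = length φs ⊔ maxFanIn φs
  fanIn (OR φs)  = length φs ⊔ maxFanIn φs

  maxFanIn : List (Formula I) → ℕ
  maxFanIn []       = 0
  maxFanIn (φ ∷ φs) = fanIn φ ⊔ maxFanIn φs

mutual
  size : Formula I → ℕ
  size (var _)  = 1
  size (lit _)  = 1
  size (neg φ)  = suc (size φ)
  size (AND φs) = suc (sizes φs)
  size (OR φs)  = suc (sizes φs)

  sizes : List (Formula I) → ℕ
  sizes []       = 0
  sizes (φ ∷ φs) = size φ + sizes φs

infixr 7 _∧ᶠ_
infixr 6 _∨ᶠ_

_∧ᶠ_ _∨ᶠ_ : Formula I → Formula I → Formula I
φ ∧ᶠ χ = AND (φ ∷ χ ∷ [])
φ ∨ᶠ χ = OR (φ ∷ χ ∷ [])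

⋁ ⋀ : (A → Formula I) → List A → Formula I
⋁ f xs = OR (map f xs)
⋀ f xs = AND (map f xs)

module _ {w : I → Bool} where

  ⊨-neg : ∀ {φ} → w ⊨ neg φ ⇔ (¬ w ⊨ φ)
  ⊨-neg {φ} = ¬-⇔ (⇔-sym ⊨⇔T) ⇔-∘ (T-not (eval w φ) ⇔-∘ ⊨⇔T)
    where
    T-not : ∀ b → T (not b) ⇔ (¬ T b)
    T-not true  = mk⇔ (λ ()) (λ ¬t → ¬t _)
    T-not false = mk⇔ (λ _ ()) _

  ⊨-AND : ∀ {φs} → w ⊨ AND φs ⇔ All (w ⊨_) φs
  ⊨-AND {φs} = mk⇔
    (All.map sat ∘ All.all⁺ (eval w) φs ∘ subst (T ∘ and) (evals-map w φs) ∘ truth)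
    (sat ∘ subst (T ∘ and) (sym (evals-map w φs)) ∘ All.all⁻ (eval w) ∘ All.map truth)

  ⊨-OR : ∀ {φs} → w ⊨ OR φs ⇔ Any (w ⊨_) φs
  ⊨-OR {φs} = mk⇔
    (Any.map sat ∘ Any.any⁻ (eval w) φs ∘ subst (T ∘ or) (evals-map w φs) ∘ truth)
    (sat ∘ subst (T ∘ or) (sym (evals-map w φs)) ∘ Any.any⁺ (eval w) ∘ Any.map truth)

  ⊨-∧ᶠ : ∀ {φ χ} → w ⊨ φ ∧ᶠ χ ⇔ (w ⊨ φ × w ⊨ χ)
  ⊨-∧ᶠ {φ} {χ} = mk⇔ (pair ∘ to ⊨-AND) (λ (p , q) → from ⊨-AND (p ∷ q ∷ []))
    where
    pair : ∀ {P : Formula I → Set} → All P (φ ∷ χ ∷ []) → P φ × P χ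
    pair (p ∷ q ∷ []) = p , q

  ⊨-∨ᶠ : ∀ {φ χ} → w ⊨ φ ∨ᶠ χ ⇔ (w ⊨ φ ⊎ w ⊨ χ)
  ⊨-∨ᶠ {φ} {χ} = mk⇔ (pair ∘ to ⊨-OR) (from ⊨-OR ∘ [ Any.here , Any.there ∘ Any.here ]′)
    where
    pair : ∀ {P : Formula I → Set} → Any P (φ ∷ χ ∷ []) → P φ ⊎ P χ
    pair (here p)         = inj₁ p
    pair (there (here q)) = inj₂ q

  ⊨-⋁ : ∀ {f : A → Formula I} {xs} → w ⊨ ⋁ f xs ⇔ Any (λ x → w ⊨ f x) xs
  ⊨-⋁ = mk⇔ (Any.map⁻ ∘ to ⊨-OR) (from ⊨-OR ∘ Any.map⁺)

  ⊨-⋀ : ∀ {f : A → Formula I} {xs} → w ⊨ ⋀ f xs ⇔ All (λ x → w ⊨ f x) xs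
  ⊨-⋀ = mk⇔ (All.map⁻ ∘ to ⊨-AND) (from ⊨-AND ∘ All.map⁺)

  ⊨-⋁-allFin : ∀ {f : Fin m → Formula I} → w ⊨ ⋁ f (allFin m) ⇔ ∃ λ i → w ⊨ f i
  ⊨-⋁-allFin = mk⇔ (λ h → let i , _ , t = find (to ⊨-⋁ h) in i , t)
                   (λ (i , t) → from ⊨-⋁ (lose (∈-allFin i) t))

maxDepth-≤ : ∀ (φs : List (Formula I)) → All (λ φ → depthᶠ φ ≤ D) φs → maxDepth φs ≤ D
maxDepth-≤ []       []       = z≤n
maxDepth-≤ (_ ∷ φs) (h ∷ hs) = ⊔-lub h (maxDepth-≤ φs hs)

maxFanIn-≤ : ∀ (φs : List (Formula I)) → All (λ φ → fanIn φ ≤ F) φs → maxFanIn φs ≤ F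
maxFanIn-≤ []       []       = z≤n
maxFanIn-≤ (_ ∷ φs) (h ∷ hs) = ⊔-lub h (maxFanIn-≤ φs hs)

depth-∧ᶠ : ∀ {φ χ : Formula I} → depthᶠ φ ≤ D → depthᶠ χ ≤ D → depthᶠ (φ ∧ᶠ χ) ≤ suc D
depth-∧ᶠ {φ = φ} {χ} p q = s≤s (maxDepth-≤ (φ ∷ χ ∷ []) (p ∷ q ∷ []))

depth-∨ᶠ : ∀ {φ χ : Formula I} → depthᶠ φ ≤ D → depthᶠ χ ≤ D → depthᶠ (φ ∨ᶠ χ) ≤ suc D
depth-∨ᶠ {φ = φ} {χ} p q = s≤s (maxDepth-≤ (φ ∷ χ ∷ []) (p ∷ q ∷ []))

depth-⋁ : ∀ {f : A → Formula I} {xs} → (∀ x → depthᶠ (f x) ≤ D) → depthᶠ (⋁ f xs) ≤ suc D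
depth-⋁ {f = f} {xs} h = s≤s (maxDepth-≤ (map f xs) (All.map⁺ (All.universal h xs)))

depth-⋀ : ∀ {f : A → Formula I} {xs} → (∀ x → depthᶠ (f x) ≤ D) → depthᶠ (⋀ f xs) ≤ suc D
depth-⋀ {f = f} {xs} h = s≤s (maxDepth-≤ (map f xs) (All.map⁺ (All.universal h xs)))

fanIn-∧ᶠ : ∀ {φ χ : Formula I} → 2 ≤ F → fanIn φ ≤ F → fanIn χ ≤ F → fanIn (φ ∧ᶠ χ) ≤ F
fanIn-∧ᶠ {φ = φ} {χ} 2≤F p q = ⊔-lub 2≤F (maxFanIn-≤ (φ ∷ χ ∷ []) (p ∷ q ∷ []))

fanIn-∨ᶠ : ∀ {φ χ : Formula I} → 2 ≤ F → fanIn φ ≤ F → fanIn χ ≤ F → fanIn (φ ∨ᶠ χ) ≤ F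
fanIn-∨ᶠ {φ = φ} {χ} 2≤F p q = ⊔-lub 2≤F (maxFanIn-≤ (φ ∷ χ ∷ []) (p ∷ q ∷ []))

fanIn-⋁ : ∀ {f : A → Formula I} {xs} → length xs ≤ F → (∀ {x} → x ∈ xs → fanIn (f x) ≤ F) →
          fanIn (⋁ f xs) ≤ F
fanIn-⋁ {f = f} {xs} len h =
  ⊔-lub (subst (_≤ _) (sym (length-map f xs)) len)
        (maxFanIn-≤ (map f xs) (All.map⁺ (All.tabulate h)))

fanIn-⋀ : ∀ {f : A → Formula I} {xs} → length xs ≤ F → (∀ {x} → x ∈ xs → fanIn (f x) ≤ F) →
          fanIn (⋀ f xs) ≤ F
fanIn-⋀ {f = f} {xs} len h =
  ⊔-lub (subst (_≤ _) (sym (length-map f xs)) len)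
        (maxFanIn-≤ (map f xs) (All.map⁺ (All.tabulate h)))

mutual
  size≤ : ∀ (φ : Formula I) → fanIn φ ≤ F → size φ ≤ suc F ^ depthᶠ φ
  size≤ (var _) _ = ≤-refl
  size≤ (lit _) _ = ≤-refl
  size≤ {F = F} (neg φ) h = begin
    suc (size φ)                             ≡⟨ +-comm 1 (size φ) ⟩
    size φ + 1                               ≤⟨ +-mono-≤ (size≤ φ (m⊔n≤o⇒n≤o 1 (fanIn φ) h)) 1≤F*X ⟩
    suc F ^ depthᶠ φ + F * suc F ^ depthᶠ φ  ∎
    where
    open ≤-Reasoning
    1≤F*X : 1 ≤ F * suc F ^ depthᶠ φ
    1≤F*X = *-mono-≤ (m⊔n≤o⇒m≤o 1 (fanIn φ) h) (m^n>0 (suc F) (depthᶠ φ))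
  size≤ (AND φs) h = gate-size≤ φs h
  size≤ (OR φs)  h = gate-size≤ φs h

  gate-size≤ : ∀ (φs : List (Formula I)) → length φs ⊔ maxFanIn φs ≤ F →
               suc (sizes φs) ≤ suc F ^ suc (maxDepth φs)
  gate-size≤ {F = F} φs h =
    +-mono-≤ (m^n>0 (suc F) (maxDepth φs))
             (≤-trans (sizes≤ φs (m⊔n≤o⇒n≤o (length φs) (maxFanIn φs) h))
                      (*-monoˡ-≤ (suc F ^ maxDepth φs) (m⊔n≤o⇒m≤o (length φs) (maxFanIn φs) h)))

  sizes≤ : ∀ (φs : List (Formula I)) → maxFanIn φs ≤ F → sizes φs ≤ length φs * suc F ^ maxDepth φs
  sizes≤ []       _ = z≤n
  sizes≤ {F = F} (φ ∷ φs) h =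
    +-mono-≤ (≤-trans (size≤ φ (m⊔n≤o⇒m≤o (fanIn φ) (maxFanIn φs) h))
                      (^-monoʳ-≤ (suc F) (m≤m⊔n (depthᶠ φ) (maxDepth φs))))
             (≤-trans (sizes≤ φs (m⊔n≤o⇒n≤o (fanIn φ) (maxFanIn φs) h))
                      (*-monoʳ-≤ (length φs) (^-monoʳ-≤ (suc F) (m≤n⊔m (depthᶠ φ) (maxDepth φs)))))

lookup-∷ʳ-inject₁ : ∀ (xs : Vec A g) x i → lookup (xs ∷ʳ x) (inject₁ i) ≡ lookup xs i
lookup-∷ʳ-inject₁ (y ∷ xs) x zero    = refl
lookup-∷ʳ-inject₁ (y ∷ xs) x (suc i) = lookup-∷ʳ-inject₁ xs x i

lookup-∷ʳ-fromℕ : ∀ (xs : Vec A g) x → lookup (xs ∷ʳ x) (fromℕ g) ≡ x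
lookup-∷ʳ-fromℕ []       x = refl
lookup-∷ʳ-fromℕ (y ∷ xs) x = lookup-∷ʳ-fromℕ xs x

∷ʳ-bounded : ∀ {xs : Vec ℕ g} {x} → (∀ i → lookup xs i ≤ D) → x ≤ D → ∀ i → lookup (xs ∷ʳ x) i ≤ D
∷ʳ-bounded {xs = []}     _ x≤D zero    = x≤D
∷ʳ-bounded {xs = y ∷ xs} h _   zero    = h zero
∷ʳ-bounded {xs = y ∷ xs} h x≤D (suc i) = ∷ʳ-bounded {xs = xs} (h ∘ suc) x≤D i

foldr-⊔-bounded : ∀ (xs : Vec ℕ g) → (∀ i → lookup xs i ≤ D) → Vec.foldr _ _⊔_ 0 xs ≤ D
foldr-⊔-bounded []       _ = z≤n
foldr-⊔-bounded (x ∷ xs) h = ⊔-lub (h zero) (foldr-⊔-bounded xs (h ∘ suc))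

-- Formulas are compiled by appending the gates of their subformulas to a growing circuit.
infix 4 _≼_
record _≼_ {g g′ : ℕ} (C : Circuit I g) (C′ : Circuit I g′) : Set where
  field
    embed       : Fin g → Fin g′
    value-embed : ∀ w i → lookup (evalAll C′ w) (embed i) ≡ lookup (evalAll C w) i
    depth-embed : ∀ i → lookup (depths C′) (embed i) ≡ lookup (depths C) i
open _≼_

≼-refl : {C : Circuit I g} → C ≼ C
≼-refl = record { embed = id ; value-embed = λ _ _ → refl ; depth-embed = λ _ → refl }

≼-trans : ∀ {g₁ g₂ g₃} {C₁ : Circuit I g₁} {C₂ : Circuit I g₂} {C₃ : Circuit I g₃} →
          C₁ ≼ C₂ → C₂ ≼ C₃ → C₁ ≼ C₃
≼-trans e₁ e₂ = record
  { embed       = embed e₂ ∘ embed e₁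
  ; value-embed = λ w i → trans (value-embed e₂ w (embed e₁ i)) (value-embed e₁ w i)
  ; depth-embed = λ i → trans (depth-embed e₂ (embed e₁ i)) (depth-embed e₁ i)
  }

≼-▷ : {C : Circuit I g} {γ : Gate I g} → C ≼ C ▷ γ
≼-▷ {C = C} = record
  { embed       = inject₁
  ; value-embed = λ w → lookup-∷ʳ-inject₁ (evalAll C w) _
  ; depth-embed = lookup-∷ʳ-inject₁ (depths C) _
  }

GatesBelow : ℕ → Circuit I g → Set
GatesBelow D C = ∀ i → lookup (depths C) i ≤ D

record Compiled (C : Circuit I g) (φ : Formula I) : Set where
  field
    top        : ℕ
    circuit    : Circuit I (suc top)
    extends    : C ≼ circuit
    gate-count : suc top ≡ g + size φ
    top-value  : ∀ w → lookup (evalAll circuit w) (fromℕ top) ≡ eval w φ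
    top-depth  : lookup (depths circuit) (fromℕ top) ≡ depthᶠ φ
    below      : GatesBelow D C → depthᶠ φ ≤ D → GatesBelow D circuit

record CompiledList (C : Circuit I g) (φs : List (Formula I)) : Set where
  field
    {gates}       : ℕ
    circuit       : Circuit I gates
    extends       : C ≼ circuit
    gate-count    : gates ≡ g + sizes φs
    outputs       : List (Fin gates)
    output-values : ∀ w → map (lookup (evalAll circuit w)) outputs ≡ evals w φs
    output-depth  : List.foldr _⊔_ 0 (map (lookup (depths circuit)) outputs) ≡ maxDepth φs
    below         : GatesBelow D C → maxDepth φs ≤ D → GatesBelow D circuit

withTopGate : ∀ {g′} {C : Circuit I g} {φ : Formula I} (C′ : Circuit I g′) (γ : Gate I g′) →
  C ≼ C′ → suc g′ ≡ g + size φ →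
  (∀ w → gateVal w (evalAll C′ w) γ ≡ eval w φ) → gateDepth (depths C′) γ ≡ depthᶠ φ →
  (∀ {D} → GatesBelow D C → depthᶠ φ ≤ D → GatesBelow D C′) → Compiled C φ
withTopGate C′ γ ext count value depth≡ below = record
  { circuit    = C′ ▷ γ
  ; extends    = ≼-trans ext ≼-▷
  ; gate-count = count
  ; top-value  = λ w → trans (lookup-∷ʳ-fromℕ (evalAll C′ w) _) (value w)
  ; top-depth  = trans (lookup-∷ʳ-fromℕ (depths C′) _) depth≡
  ; below      = λ h φ≤D → ∷ʳ-bounded {xs = depths C′} (below h φ≤D)
                                       (subst (_≤ _) (sym depth≡) φ≤D)
  }

mutual
  compile : (C : Circuit I g) (φ : Formula I) → Compiled C φ
  compile {g = g} C (var i) =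
    withTopGate C (input i) ≼-refl (+-comm 1 g) (λ _ → refl) refl (λ h _ → h)
  compile {g = g} C (lit b) =
    withTopGate C (const b) ≼-refl (+-comm 1 g) (λ _ → refl) refl (λ h _ → h)
  compile {g = g} C (neg φ) =
    withTopGate circuit (notg (fromℕ top)) extends
      (trans (cong suc gate-count) (sym (+-suc g (size φ))))
      (λ w → cong not (top-value w)) (cong suc top-depth)
      (λ h le → below h (≤-trans (n≤1+n _) le))
    where open Compiled (compile C φ)
  compile {g = g} C (AND φs) =
    withTopGate circuit (andg outputs) extends
      (trans (cong suc gate-count) (sym (+-suc g (sizes φs))))
      (λ w → cong and (output-values w)) (cong suc output-depth)
      (λ h le → below h (≤-trans (n≤1+n _) le))
    where open CompiledList (compileList C φs)
  compile {g = g} C (OR φs) =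
    withTopGate circuit (org outputs) extends
      (trans (cong suc gate-count) (sym (+-suc g (sizes φs))))
      (λ w → cong or (output-values w)) (cong suc output-depth)
      (λ h le → below h (≤-trans (n≤1+n _) le))
    where open CompiledList (compileList C φs)

  compileList : (C : Circuit I g) (φs : List (Formula I)) → CompiledList C φs
  compileList {g = g} C [] = record
    { circuit = C ; extends = ≼-refl ; gate-count = sym (+-identityʳ g) ; outputs = []
    ; output-values = λ _ → refl ; output-depth = refl ; below = λ h _ → h }
  compileList {g = g} C (φ ∷ φs) = record
    { circuit       = Rest.circuit
    ; extends       = ≼-trans Head.extends Rest.extends
    ; gate-count    = trans Rest.gate-count
                        (trans (cong (_+ sizes φs) Head.gate-count) (+-assoc g (size φ) (sizes φs)))
    ; outputs       = embed Rest.extends (fromℕ Head.top) ∷ Rest.outputs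
    ; output-values = λ w → cong₂ _∷_ (trans (value-embed Rest.extends w _) (Head.top-value w))
                                      (Rest.output-values w)
    ; output-depth  = cong₂ _⊔_ (trans (depth-embed Rest.extends _) Head.top-depth)
                                Rest.output-depth
    ; below         = λ h le → Rest.below (Head.below h (≤-trans (m≤m⊔n _ _) le))
                                          (≤-trans (m≤n⊔m _ _) le)
    }
    where
    module Head = Compiled (compile C φ)
    module Rest = CompiledList (compileList Head.circuit φs)

toCircuit : Formula I → Σ ℕ λ s → Circuit I (suc s)
toCircuit φ = top , circuit
  where open Compiled (compile [] φ)

toCircuit-output : ∀ (φ : Formula I) w → output (proj₂ (toCircuit φ)) w ≡ eval w φ
toCircuit-output φ = Compiled.top-value (compile [] φ)

toCircuit-gates : ∀ (φ : Formula I) → suc (proj₁ (toCircuit φ)) ≡ size φ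
toCircuit-gates φ = Compiled.gate-count (compile [] φ)

toCircuit-depth : ∀ (φ : Formula I) → depth (proj₂ (toCircuit φ)) ≤ depthᶠ φ
toCircuit-depth φ = foldr-⊔-bounded (depths circuit) (below (λ ()) ≤-refl)
  where open Compiled (compile [] φ)

^-distribʳ-* : ∀ a b c → (a * b) ^ c ≡ a ^ c * b ^ c
^-distribʳ-* a b zero    = refl
^-distribʳ-* a b (suc c) =
  trans (cong (a * b *_) (^-distribʳ-* a b c)) ([m*n]*[o*p]≡[m*o]*[n*p] a b (a ^ c) (b ^ c))

lg : ℕ → ℕ
lg zero    = zero
lg (suc n) with suc n ≤? 2 ^ lg n
... | yes _ = lg n
... | no  _ = suc (lg n)

2^-suc : ∀ m → 2 ^ suc m ≡ 2 ^ m + 2 ^ m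
2^-suc m = cong (2 ^ m +_) (+-identityʳ (2 ^ m))

lg-bounds : ∀ n → n ≤ 2 ^ lg n × 2 ^ lg n ≤ suc (n + n)
lg-bounds zero = z≤n , s≤s z≤n
lg-bounds (suc n) with suc n ≤? 2 ^ lg n | lg-bounds n
... | yes n<2^l | _ , 2^l≤ = n<2^l , ≤-trans 2^l≤ (s≤s (+-mono-≤ (n≤1+n n) (n≤1+n n)))
... | no  n≮2^l | n≤2^l , _ =
  subst (suc n ≤_) (sym (2^-suc (lg n))) (+-mono-≤ (m^n>0 2 (lg n)) n≤2^l) ,
  subst (_≤ suc (suc n + suc n)) (sym (2^-suc (lg n)))
        (≤-trans (+-mono-≤ 2^l≤n 2^l≤n) (≤-trans (+-mono-≤ (n≤1+n n) (n≤1+n n)) (n≤1+n _)))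
  where
  2^l≤n : 2 ^ lg n ≤ n
  2^l≤n = ≮⇒≥ n≮2^l

1+n≤2^n : ∀ n → suc n ≤ 2 ^ n
1+n≤2^n zero    = s≤s z≤n
1+n≤2^n (suc n) = subst (suc (suc n) ≤_) (sym (2^-suc n)) (+-mono-≤ (m^n>0 2 n) (1+n≤2^n n))

n^k≤k^k*2^n : ∀ n k → n ^ k ≤ k ^ k * 2 ^ n
n^k≤k^k*2^n n zero    = ≤-trans (m^n>0 2 n) (≤-reflexive (sym (+-identityʳ (2 ^ n))))
n^k≤k^k*2^n n (suc k) = begin
  n ^ suc k                        ≤⟨ ^-monoˡ-≤ (suc k) n≤[1+q][1+k] ⟩
  (suc q * suc k) ^ suc k          ≡⟨ ^-distribʳ-* (suc q) (suc k) (suc k) ⟩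
  suc q ^ suc k * suc k ^ suc k    ≤⟨ *-monoˡ-≤ (suc k ^ suc k) (^-monoˡ-≤ (suc k) (1+n≤2^n q)) ⟩
  (2 ^ q) ^ suc k * suc k ^ suc k  ≡⟨ cong (_* suc k ^ suc k) (^-*-assoc 2 q (suc k)) ⟩
  2 ^ (q * suc k) * suc k ^ suc k  ≤⟨ *-monoˡ-≤ (suc k ^ suc k) (^-monoʳ-≤ 2 (m/n*n≤m n (suc k))) ⟩
  2 ^ n * suc k ^ suc k            ≡⟨ *-comm (2 ^ n) (suc k ^ suc k) ⟩
  suc k ^ suc k * 2 ^ n            ∎
  where
  open ≤-Reasoning
  q = n / suc k
  n≤[1+q][1+k] : n ≤ suc q * suc k
  n≤[1+q][1+k] = begin
    n                     ≡⟨ m≡m%n+[m/n]*n n (suc k) ⟩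
    n % suc k + q * suc k ≤⟨ +-monoˡ-≤ (q * suc k) (<⇒≤ (m%n<n n (suc k))) ⟩
    suc k + q * suc k     ∎

adjacency : Graph n → Fin n × Fin n → Bool
adjacency G (i , j) = adj G i j

paraAC0-fromFormulas : ∀ {Q : (n : ℕ) → Graph n → ℕ → Set}
  (Φ : (n k : ℕ) → Formula (Fin n × Fin n)) (f : ℕ → ℕ) (d : ℕ) →
  (∀ n k → fanIn (Φ n k) ≤ f k * suc n) →
  (∀ n k → depthᶠ (Φ n k) ≤ d) →
  (∀ n k (G : Graph n) → adjacency G ⊨ Φ n k ⇔ Q n G k) →
  ParaAC0 Q
paraAC0-fromFormulas Φ f d fanIn≤ depth≤ correct =
  (λ k → suc (f k) ^ d) , d , d , (λ n k → toCircuit (Φ n k)) ,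
  (λ n k → gates≤ n k , ≤-trans (toCircuit-depth (Φ n k)) (depth≤ n k)) ,
  λ n k G → correct n k G ⇔-∘ mk⇔ (sat ∘ from T-≡ ∘ trans (sym (toCircuit-output (Φ n k) _)))
                                   (trans (toCircuit-output (Φ n k) _) ∘ to T-≡ ∘ truth)
  where
  gates≤ : ∀ n k → suc (proj₁ (toCircuit (Φ n k))) ≤ suc (f k) ^ d * suc n ^ d
  gates≤ n k = begin
    suc (proj₁ (toCircuit (Φ n k)))  ≡⟨ toCircuit-gates (Φ n k) ⟩
    size (Φ n k)                     ≤⟨ size≤ (Φ n k) (fanIn≤ n k) ⟩
    suc (f k * suc n) ^ depthᶠ (Φ n k) ≤⟨ ^-monoʳ-≤ (suc (f k * suc n)) (depth≤ n k) ⟩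
    suc (f k * suc n) ^ d            ≤⟨ ^-monoˡ-≤ d (s≤s (m≤n+m (f k * suc n) n)) ⟩
    (suc (f k) * suc n) ^ d          ≡⟨ ^-distribʳ-* (suc (f k)) (suc n) d ⟩
    suc (f k) ^ d * suc n ^ d        ∎
    where open ≤-Reasoning

assign : Fin n → Fin n → Var → Fin n
assign a b vx = a
assign a b vy = b

qfFormula : QF → Fin n → Fin n → Formula (Fin n × Fin n)
qfFormula ⊤f         _ _ = lit true
qfFormula ⊥f         _ _ = lit false
qfFormula (adjf u v) a b = var (assign a b u , assign a b v)
qfFormula (eqf u v)  a b = lit (does (assign a b u Fin.≟ assign a b v))
qfFormula (¬f ψ)     a b = neg (qfFormula ψ a b)
qfFormula (ψ ∧f χ)   a b = qfFormula ψ a b ∧ᶠ qfFormula χ a b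
qfFormula (ψ ∨f χ)   a b = qfFormula ψ a b ∨ᶠ qfFormula χ a b

qfDepth : QF → ℕ
qfDepth (¬f ψ)   = suc (qfDepth ψ)
qfDepth (ψ ∧f χ) = suc (qfDepth ψ ⊔ qfDepth χ)
qfDepth (ψ ∨f χ) = suc (qfDepth ψ ⊔ qfDepth χ)
qfDepth _        = 0

eval-qfFormula : ∀ (G : Graph n) ψ a b → eval (adjacency G) (qfFormula ψ a b) ≡ evalQF G ψ a b
eval-qfFormula G ⊤f          a b = refl
eval-qfFormula G ⊥f          a b = refl
eval-qfFormula G (adjf vx vx) a b = refl
eval-qfFormula G (adjf vx vy) a b = refl
eval-qfFormula G (adjf vy vx) a b = refl
eval-qfFormula G (adjf vy vy) a b = refl
eval-qfFormula G (eqf vx vx)  a b = refl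
eval-qfFormula G (eqf vx vy)  a b = refl
eval-qfFormula G (eqf vy vx)  a b = refl
eval-qfFormula G (eqf vy vy)  a b = refl
eval-qfFormula G (¬f ψ)       a b = cong not (eval-qfFormula G ψ a b)
eval-qfFormula G (ψ ∧f χ)     a b =
  cong₂ _∧_ (eval-qfFormula G ψ a b) (trans (∧-identityʳ _) (eval-qfFormula G χ a b))
eval-qfFormula G (ψ ∨f χ)     a b =
  cong₂ _∨_ (eval-qfFormula G ψ a b) (trans (∨-identityʳ _) (eval-qfFormula G χ a b))

depth-qfFormula : ∀ ψ (a b : Fin n) → depthᶠ (qfFormula ψ a b) ≤ qfDepth ψ
depth-qfFormula ⊤f         a b = z≤n
depth-qfFormula ⊥f         a b = z≤n
depth-qfFormula (adjf u v) a b = z≤n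
depth-qfFormula (eqf u v)  a b = z≤n
depth-qfFormula (¬f ψ)     a b = s≤s (depth-qfFormula ψ a b)
depth-qfFormula (ψ ∧f χ)   a b =
  depth-∧ᶠ (≤-trans (depth-qfFormula ψ a b) (m≤m⊔n _ _))
           (≤-trans (depth-qfFormula χ a b) (m≤n⊔m _ _))
depth-qfFormula (ψ ∨f χ)   a b =
  depth-∨ᶠ (≤-trans (depth-qfFormula ψ a b) (m≤m⊔n _ _))
           (≤-trans (depth-qfFormula χ a b) (m≤n⊔m _ _))

fanIn-qfFormula : ∀ ψ (a b : Fin n) → fanIn (qfFormula ψ a b) ≤ 2
fanIn-qfFormula ⊤f         a b = z≤n
fanIn-qfFormula ⊥f         a b = z≤n
fanIn-qfFormula (adjf u v) a b = z≤n
fanIn-qfFormula (eqf u v)  a b = z≤n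
fanIn-qfFormula (¬f ψ)     a b = ⊔-lub (s≤s z≤n) (fanIn-qfFormula ψ a b)
fanIn-qfFormula (ψ ∧f χ)   a b =
  fanIn-∧ᶠ {φ = qfFormula ψ a b} {qfFormula χ a b} ≤-refl
           (fanIn-qfFormula ψ a b) (fanIn-qfFormula χ a b)
fanIn-qfFormula (ψ ∨f χ)   a b =
  fanIn-∨ᶠ {φ = qfFormula ψ a b} {qfFormula χ a b} ≤-refl
           (fanIn-qfFormula ψ a b) (fanIn-qfFormula χ a b)

onDistinct : QF → Bool → Bool → Bool → Bool
onDistinct ⊤f           _  _  _ = true
onDistinct ⊥f           _  _  _ = false
onDistinct (adjf vx vx) lx _  _ = lx
onDistinct (adjf vy vy) _  ly _ = ly
onDistinct (adjf _ _)   _  _  e = e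
onDistinct (eqf vx vx)  _  _  _ = true
onDistinct (eqf vy vy)  _  _  _ = true
onDistinct (eqf _ _)    _  _  _ = false
onDistinct (¬f ψ)       lx ly e = not (onDistinct ψ lx ly e)
onDistinct (ψ ∧f χ)     lx ly e = onDistinct ψ lx ly e ∧ onDistinct χ lx ly e
onDistinct (ψ ∨f χ)     lx ly e = onDistinct ψ lx ly e ∨ onDistinct χ lx ly e

evalQF-onDistinct : ∀ (G : Graph n) ψ {a b} → a ≢ b →
  evalQF G ψ a b ≡ onDistinct ψ (adj G a a) (adj G b b) (adj G a b)
evalQF-onDistinct G ⊤f           a≢b = refl
evalQF-onDistinct G ⊥f           a≢b = refl
evalQF-onDistinct G (adjf vx vx) a≢b = refl
evalQF-onDistinct G (adjf vx vy) a≢b = refl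
evalQF-onDistinct G (adjf vy vx) {a} {b} a≢b = adj-sym G b a
evalQF-onDistinct G (adjf vy vy) a≢b = refl
evalQF-onDistinct G (eqf vx vx) {a} a≢b = dec-true (a Fin.≟ a) refl
evalQF-onDistinct G (eqf vx vy) {a} {b} a≢b = dec-false (a Fin.≟ b) a≢b
evalQF-onDistinct G (eqf vy vx) {a} {b} a≢b = dec-false (b Fin.≟ a) (a≢b ∘ sym)
evalQF-onDistinct G (eqf vy vy) {a} {b} a≢b = dec-true (b Fin.≟ b) refl
evalQF-onDistinct G (¬f ψ)   a≢b = cong not (evalQF-onDistinct G ψ a≢b)
evalQF-onDistinct G (ψ ∧f χ) a≢b = cong₂ _∧_ (evalQF-onDistinct G ψ a≢b) (evalQF-onDistinct G χ a≢b)
evalQF-onDistinct G (ψ ∨f χ) a≢b = cong₂ _∨_ (evalQF-onDistinct G ψ a≢b) (evalQF-onDistinct G χ a≢b)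

true≢false : true ≢ false
true≢false ()

module _ (p : Bool → Bool → Bool → Bool) where

  Oriented : Bool → Bool → Bool → Set
  Oriented l l′ e = p l l′ e ≡ true × p l′ l e ≡ false

  oriented-flips : ∀ {l l′ e} → Oriented l l′ e → l′ ≡ not l
  oriented-flips (t , f) = ¬-not λ { refl → true≢false (trans (sym t) f) }

  -- The two edge values at which p l l′ differs exhaust Bool.
  oriented-back-and-forth : ∀ {l l′ e₁ e₂} → Oriented l l′ e₁ → Oriented l′ l e₂ →
                            ∀ e → p l l′ e ≡ true ⊎ p l′ l e ≡ true
  oriented-back-and-forth {e₁ = false} {false} (t₁ , _) (_ , f₂) _ =
    ⊥-elim (true≢false (trans (sym t₁) f₂))
  oriented-back-and-forth {e₁ = true}  {true}  (t₁ , _) (_ , f₂) _ =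
    ⊥-elim (true≢false (trans (sym t₁) f₂))
  oriented-back-and-forth {e₁ = false} {true}  (t₁ , _) _        false = inj₁ t₁
  oriented-back-and-forth {e₁ = false} {true}  _        (t₂ , _) true  = inj₂ t₂
  oriented-back-and-forth {e₁ = true}  {false} (t₁ , _) _        true  = inj₁ t₁
  oriented-back-and-forth {e₁ = true}  {false} _        (t₂ , _) false = inj₂ t₂

does⇔ : (A? : Dec A) → does A? ≡ true ⇔ A
does⇔ (yes a) = mk⇔ (λ _ → a) (λ _ → refl)
does⇔ (no ¬a) = mk⇔ (λ ()) (⊥-elim ∘ ¬a)

∈-tabulate⇔ : ∀ (f : Fin n → Bool) {x} → x ∈ₛ tabulate f ⇔ f x ≡ true
∈-tabulate⇔ f {x} = mk⇔ (λ x∈ → trans (sym (lookup∘tabulate f x)) ([]=⇒lookup x∈))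
                        (λ fx → lookup⇒[]= x _ (trans (lookup∘tabulate f x) fx))

subsetOf : {P : Fin n → Set} → (∀ x → Dec (P x)) → Subset n
subsetOf P? = tabulate (does ∘ P?)

∈-subsetOf : {P : Fin n → Set} (P? : ∀ x → Dec (P x)) {x : Fin n} → x ∈ₛ subsetOf P? ⇔ P x
∈-subsetOf P? {x} = does⇔ (P? x) ⇔-∘ ∈-tabulate⇔ (does ∘ P?)

members : Subset n → List (Fin n)
members []            = []
members (inside ∷ S)  = zero ∷ map suc (members S)
members (outside ∷ S) = map suc (members S)

length-members : ∀ (S : Subset n) → length (members S) ≡ ∣ S ∣
length-members []            = refl
length-members (inside ∷ S)  = cong suc (trans (length-map suc (members S)) (length-members S))
length-members (outside ∷ S) = trans (length-map suc (members S)) (length-members S)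

members-unique : ∀ (S : Subset n) → Unique (members S)
members-unique []            = []
members-unique (inside ∷ S)  =
  All.map⁺ (All.universal (λ _ ()) (members S)) ∷ Unique.map⁺ Fin.suc-injective (members-unique S)
members-unique (outside ∷ S) = Unique.map⁺ Fin.suc-injective (members-unique S)

members-⊆ : ∀ (S : Subset n) → All (_∈ₛ S) (members S)
members-⊆ []            = []
members-⊆ (inside ∷ S)  = here ∷ All.map⁺ (All.map there (members-⊆ S))
members-⊆ (outside ∷ S) = All.map⁺ (All.map there (members-⊆ S))

distinct-members : ∀ (S : Subset n) → k ≤ ∣ S ∣ →
                   ∃ λ vs → Unique vs × All (_∈ₛ S) vs × length vs ≡ k
distinct-members {k = k} S k≤∣S∣ =
  take k (members S) , Unique.take⁺ k (members-unique S) , All.take⁺ k (members-⊆ S) ,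
  trans (length-take k (members S)) (trans (cong (k ⊓_) (length-members S)) (m≤n⇒m⊓n≡m k≤∣S∣))

distinct-images-≤ : ∀ (f : Fin n → B) {S : Subset n} {qs : List B} → Unique qs →
                    All (λ q → ∃ λ v → v ∈ₛ S × f v ≡ q) qs → length qs ≤ ∣ S ∣
distinct-images-≤ f []         []                       = z≤n
distinct-images-≤ f (fv∉ ∷ qs!) ((v , v∈S , refl) ∷ hits) =
  ≤-<-trans (distinct-images-≤ f qs! (All.zipWith avoid (fv∉ , hits))) (x∈p⇒∣p-x∣<∣p∣ v∈S)
  where
  avoid : ∀ {q} → f v ≢ q × (∃ λ u → u ∈ₛ _ × f u ≡ q) → ∃ λ u → u ∈ₛ _ - v × f u ≡ q
  avoid (fv≢q , u , u∈S , fu≡q) = u , x∈p∧x≢y⇒x∈p-y u∈S (λ { refl → fv≢q fu≡q }) , fu≡q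

module ShortCycles {n : ℕ} (G : Graph n) (ψ : QF) where

  infix 4 _↝_
  _↝_ : Fin n → Fin n → Set
  x ↝ y = evalQF G ψ x y ≡ true

  _↝?_ : ∀ x y → Dec (x ↝ y)
  x ↝? y = evalQF G ψ x y Bool.≟ true

  Walk : ℕ → Fin n → Fin n → Set
  Walk zero    x y = x ≡ y
  Walk (suc m) x y = ∃ λ z → x ↝ z × Walk m z y

  walk? : ∀ m x y → Dec (Walk m x y)
  walk? zero    x y = x Fin.≟ y
  walk? (suc m) x y = any? λ z → (x ↝? z) ×-dec walk? m z y

  walk-snoc : ∀ {m x y z} → Walk m x y → y ↝ z → Walk (suc m) x z
  walk-snoc {zero}  refl               y↝z = _ , y↝z , refl
  walk-snoc {suc m} (v , x↝v , v⋯y) y↝z = v , x↝v , walk-snoc v⋯y y↝z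

  rotate : ∀ {m x} → Walk (suc m) x x → ∃ λ y → x ↝ y × Walk (suc m) y y
  rotate (y , x↝y , y⋯x) = y , x↝y , walk-snoc y⋯x x↝y

  OnShortCycle : Fin n → Set
  OnShortCycle x = Walk 2 x x ⊎ Walk 4 x x

  onShortCycle? : ∀ x → Dec (OnShortCycle x)
  onShortCycle? x = walk? 2 x x ⊎-dec walk? 4 x x

  onShortCycle-step : ∀ {x} → OnShortCycle x → ∃ λ y → x ↝ y × OnShortCycle y
  onShortCycle-step (inj₁ cycle) = Product.map₂ (Product.map₂ inj₁) (rotate cycle)
  onShortCycle-step (inj₂ cycle) = Product.map₂ (Product.map₂ inj₂) (rotate cycle)

  twoCycle : ∀ {x y} → x ↝ y → y ↝ x → OnShortCycle x
  twoCycle x↝y y↝x = inj₁ (_ , x↝y , _ , y↝x , refl)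

  loop : Fin n → Bool
  loop x = adj G x x

  oriented : ∀ {x y} → ¬ OnShortCycle x → x ↝ y →
             x ≢ y × Oriented (onDistinct ψ) (loop x) (loop y) (adj G x y)
  oriented {x} {y} ¬cx x↝y = x≢y , trans (sym (evalQF-onDistinct G ψ x≢y)) x↝y , y↝̸x
    where
    x≢y : x ≢ y
    x≢y refl = ¬cx (twoCycle x↝y x↝y)
    y↝̸x : onDistinct ψ (loop y) (loop x) (adj G x y) ≡ false
    y↝̸x = begin
      onDistinct ψ (loop y) (loop x) (adj G x y)  ≡⟨ cong (onDistinct ψ _ _) (adj-sym G x y) ⟩
      onDistinct ψ (loop y) (loop x) (adj G y x)  ≡⟨ sym (evalQF-onDistinct G ψ (x≢y ∘ sym)) ⟩
      evalQF G ψ y x                              ≡⟨ ¬-not (¬cx ∘ twoCycle x↝y) ⟩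
      false                                       ∎
      where open ≡-Reasoning

  -- The loops alternate along x ↝ y ↝ z ↝ u, so ψ(x, u) and ψ(u, x) are ψ(x, y) and ψ(y, x)
  -- evaluated at the edge x ∼ u, which equals x ∼ y (giving x ↝ u) or y ∼ z (giving the
  -- 4-cycle x ↝ y ↝ z ↝ u ↝ x).
  shortcut : ∀ {x y z u} → ¬ OnShortCycle x → ¬ OnShortCycle y → ¬ OnShortCycle z →
             x ↝ y → y ↝ z → z ↝ u → x ↝ u
  shortcut {x} {y} {z} {u} ¬cx ¬cy ¬cz x↝y y↝z z↝u =
    [ forth , ⊥-elim ∘ ¬cx ∘ closes ]′ (oriented-back-and-forth p x→y y→x (adj G x u))
    where
    p = onDistinct ψ
    x→y = proj₂ (oriented ¬cx x↝y)
    y→z = proj₂ (oriented ¬cy y↝z)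
    z→u = proj₂ (oriented ¬cz z↝u)
    ly≡ : loop y ≡ not (loop x)
    ly≡ = oriented-flips p x→y
    lz≡lx : loop z ≡ loop x
    lz≡lx = trans (oriented-flips p y→z) (trans (cong not ly≡) (not-involutive (loop x)))
    lu≡ly : loop u ≡ loop y
    lu≡ly = trans (oriented-flips p z→u) (trans (cong not lz≡lx) (sym ly≡))
    y→x : Oriented p (loop y) (loop x) (adj G y z)
    y→x = subst (λ l → Oriented p (loop y) l (adj G y z)) lz≡lx y→z
    x≢u : x ≢ u
    x≢u refl = not-¬ refl (trans lu≡ly ly≡)
    forth : p (loop x) (loop y) (adj G x u) ≡ true → x ↝ u
    forth t = trans (evalQF-onDistinct G ψ x≢u)
                    (subst (λ l → p (loop x) l (adj G x u) ≡ true) (sym lu≡ly) t)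
    closes : p (loop y) (loop x) (adj G x u) ≡ true → OnShortCycle x
    closes t = inj₂ (y , x↝y , z , y↝z , u , z↝u , x , u↝x , refl)
      where
      u↝x : u ↝ x
      u↝x = trans (evalQF-onDistinct G ψ (x≢u ∘ sym))
                  (subst₂ (λ l e → p l (loop x) e ≡ true) (sym lu≡ly) (adj-sym G x u) t)

  NearShortCycle : Fin n → Set
  NearShortCycle x = ∃ λ c → OnShortCycle c × ∃ λ (m : Fin 3) → Walk (toℕ m) x c

  near? : ∀ x → Dec (NearShortCycle x)
  near? x = any? λ c → onShortCycle? c ×-dec any? λ m → walk? (toℕ m) x c

  onShortCycle⇒near : ∀ {x} → OnShortCycle x → NearShortCycle x
  onShortCycle⇒near cycle = _ , cycle , zero , refl

  ¬near⇒¬on : ∀ {x} → ¬ NearShortCycle x → ¬ OnShortCycle x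
  ¬near⇒¬on ¬nx = ¬nx ∘ onShortCycle⇒near

  near-step : ∀ {x} → NearShortCycle x → ∃ λ y → x ↝ y × NearShortCycle y
  near-step (c , cycle , zero , refl) =
    Product.map₂ (Product.map₂ onShortCycle⇒near) (onShortCycle-step cycle)
  near-step (c , cycle , suc zero , (y , x↝y , refl)) = y , x↝y , onShortCycle⇒near cycle
  near-step (c , cycle , suc (suc zero) , (y , x↝y , y⋯c)) = y , x↝y , (c , cycle , suc zero , y⋯c)

  near-pred : ∀ {x y} → x ↝ y → NearShortCycle y → NearShortCycle x
  near-pred x↝y (c , cycle , zero , refl) = c , cycle , suc zero , (c , x↝y , refl)
  near-pred x↝y (c , cycle , suc zero , y⋯c) = c , cycle , suc (suc zero) , (_ , x↝y , y⋯c)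
  near-pred {x} {y} x↝y (c , cycle , suc (suc zero) , (z , y↝z , (_ , z↝c , refl)))
    with onShortCycle? x | onShortCycle? y | onShortCycle? z
  ... | yes cx | _      | _      = onShortCycle⇒near cx
  ... | no _   | yes cy | _      = y , cy , suc zero , (y , x↝y , refl)
  ... | no _   | no _   | yes cz = z , cz , suc (suc zero) , (y , x↝y , z , y↝z , refl)
  ... | no ¬cx | no ¬cy | no ¬cz =
    c , cycle , suc zero , (c , shortcut ¬cx ¬cy ¬cz x↝y y↝z z↝c , refl)

  module _ (S : Subset n) (escape : ∀ x → x ∉ₛ S → ∃ λ y → y ∉ₛ S × x ↝ y) where

    Stuck : Fin n → Set
    Stuck x = x ∉ₛ S × ¬ NearShortCycle x

    stuckSuccessor? : ∀ x u → Dec (Stuck u × x ↝ u)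
    stuckSuccessor? x u = (¬? (u ∈? S) ×-dec ¬? (near? u)) ×-dec (x ↝? u)

    stuckSuccessors : Fin n → Subset n
    stuckSuccessors x = subsetOf (stuckSuccessor? x)

    -- Two escape steps x ↝ y ↝ z from a stuck x lose y from the stuck successors, by shortcut.
    stuck-descent : ∀ {x} → Stuck x → ∃ λ z → stuckSuccessors z ⊂ stuckSuccessors x × Stuck z
    stuck-descent {x} (x∉S , ¬nx) with escape x x∉S
    ... | y , y∉S , x↝y with escape y y∉S
    ... | z , z∉S , y↝z = z , (narrower , y , y-left , y-gone) , z∉S , ¬nz
      where
      ¬ny = ¬nx ∘ near-pred x↝y
      ¬nz = ¬ny ∘ near-pred y↝z
      narrower : stuckSuccessors z ⊆ stuckSuccessors x
      narrower u∈ = let stuck , z↝u = to (∈-subsetOf (stuckSuccessor? z)) u∈ in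
        from (∈-subsetOf (stuckSuccessor? x))
             (stuck , shortcut (¬near⇒¬on ¬nx) (¬near⇒¬on ¬ny) (¬near⇒¬on ¬nz) x↝y y↝z z↝u)
      y-left : y ∈ₛ stuckSuccessors x
      y-left = from (∈-subsetOf (stuckSuccessor? x)) ((y∉S , ¬ny) , x↝y)
      y-gone : y ∉ₛ stuckSuccessors z
      y-gone y∈ = ¬near⇒¬on ¬ny (twoCycle y↝z (proj₂ (to (∈-subsetOf (stuckSuccessor? z)) y∈)))

    survivors-near : ∀ {x} → x ∉ₛ S → NearShortCycle x
    survivors-near {x} x∉S = decidable-stable (near? x) λ ¬nx →
      descent∧wf⇒empty {_<_ = _⊂_ on stuckSuccessors} {P = Stuck} stuck-descent
        (On.wellFounded stuckSuccessors ⊂-wellFounded) x (x∉S , ¬nx)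

  far : Subset n
  far = subsetOf (¬? ∘ near?)

  ∉far⇔near : ∀ {x} → x ∉ₛ far ⇔ NearShortCycle x
  ∉far⇔near {x} = mk⇔ (λ x∉ → decidable-stable (near? x) (x∉ ∘ from (∈-subsetOf (¬? ∘ near?))))
                      (λ nx x∈ → to (∈-subsetOf (¬? ∘ near?)) x∈ nx)

  vd-ae⇔∃near×∣far∣≤k : ∀ {k} → vd-ae ψ n G k ⇔ (∃ NearShortCycle × ∣ far ∣ ≤ k)
  vd-ae⇔∃near×∣far∣≤k = mk⇔ necessary sufficient
    where
    necessary : ∀ {k} → vd-ae ψ n G k → ∃ NearShortCycle × ∣ far ∣ ≤ k
    necessary (S , ∣S∣≤k , (z , z∉S) , escape) =
      (z , survivors-near S escape z∉S) , ≤-trans (p⊆q⇒∣p∣≤∣q∣ far⊆S) ∣S∣≤k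
      where
      far⊆S : far ⊆ S
      far⊆S {v} v∈far with v ∈? S
      ... | yes v∈S = v∈S
      ... | no  v∉S = ⊥-elim (to (∈-subsetOf (¬? ∘ near?)) v∈far (survivors-near S escape v∉S))
    sufficient : ∀ {k} → ∃ NearShortCycle × ∣ far ∣ ≤ k → vd-ae ψ n G k
    sufficient ((z , nz) , ∣far∣≤k) = far , ∣far∣≤k , (z , from ∉far⇔near nz) , escape
      where
      escape : ∀ x → x ∉ₛ far → ∃ λ y → y ∉ₛ far × x ↝ y
      escape x x∉far = let y , x↝y , ny = near-step (to ∉far⇔near x∉far) in
                       y , from ∉far⇔near ny , x↝y

tuples : ℕ → List A → List (List A)
tuples zero    xs = [] ∷ []
tuples (suc m) xs = cartesianProductWith _∷_ xs (tuples m xs)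

length-cartesianProductWith : ∀ (f : A → B → C) xs ys →
                              length (cartesianProductWith f xs ys) ≡ length xs * length ys
length-cartesianProductWith f []       ys = refl
length-cartesianProductWith f (x ∷ xs) ys = trans (length-++ (map (f x) ys))
  (cong₂ _+_ (length-map (f x) ys) (length-cartesianProductWith f xs ys))

length-tuples : ∀ m (xs : List A) → length (tuples m xs) ≡ length xs ^ m
length-tuples zero    xs = refl
length-tuples (suc m) xs =
  trans (length-cartesianProductWith _∷_ xs (tuples m xs))
        (cong (length xs *_) (length-tuples m xs))

∈-tuples : ∀ {xs ys : List A} → All (_∈ xs) ys → ys ∈ tuples (length ys) xs
∈-tuples []            = here refl
∈-tuples (y∈ ∷ ys∈xs) = ∈-cartesianProductWith⁺ _∷_ y∈ (∈-tuples ys∈xs)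

tuples-length : ∀ m {xs ys : List A} → ys ∈ tuples m xs → length ys ≡ m
tuples-length zero    (here refl) = refl
tuples-length (suc m) {xs} ys∈ with ∈-cartesianProductWith⁻ _∷_ xs (tuples m xs) ys∈
... | _ , _ , _ , ys′∈ , refl = cong suc (tuples-length m ys′∈)

module Separation {P B : Set} (_≟_ : DecidableEquality B) (coordinate : A → P → B)
                  (separate : ∀ {u v} → u ≢ v → ∃ λ p → coordinate u p ≢ coordinate v p) where

  signature : List P → A → List B
  signature ps v = map (coordinate v) ps

  Separates : List P → List A → Set
  Separates ps = AllPairs (λ u v → signature ps u ≢ signature ps v)

  separates-∷ : ∀ {p ps vs} → Separates ps vs → Separates (p ∷ ps) vs
  separates-∷ = AllPairs.map (λ ≢ps eq → ≢ps (proj₂ (∷-injective eq)))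

  separated-injective : ∀ {ps vs u v} → Separates ps vs → u ∈ vs → v ∈ vs →
                        signature ps u ≡ signature ps v → u ≡ v
  separated-injective _           (here refl) (here refl) _  = refl
  separated-injective (u∉ ∷ _)    (here refl) (there v∈)  eq = ⊥-elim (All.lookup u∉ v∈ eq)
  separated-injective (v∉ ∷ _)    (there u∈)  (here refl) eq = ⊥-elim (All.lookup v∉ u∈ (sym eq))
  separated-injective (_ ∷ sep)   (there u∈)  (there v∈)  eq = separated-injective sep u∈ v∈ eq

  collider : ∀ {ps v vs} → Separates ps (v ∷ vs) → ∀ a →
             ∃ λ x → x ∈ v ∷ vs × (∀ {d} → d ∈ v ∷ vs → signature ps d ≡ signature ps a → d ≡ x)
  collider {ps} {v} {vs} sep a
    with Any.any? (λ x → ≡-dec _≟_ (signature ps x) (signature ps a)) (v ∷ vs)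
  ... | yes hit = let x , x∈ , x≈a = find hit in
                  x , x∈ , λ d∈ d≈a → separated-injective sep d∈ x∈ (trans d≈a (sym x≈a))
  ... | no miss = v , here refl , λ d∈ d≈a → ⊥-elim (miss (lose d∈ d≈a))

  -- Adding one coordinate that separates a from its collider separates a ∷ vs.
  separating : ∀ a vs → Unique (a ∷ vs) → ∃ λ ps → length ps ≡ length vs × Separates ps (a ∷ vs)
  separating a []       _              = [] , refl , [] ∷ []
  separating a (v ∷ vs) (a∉ ∷ vs!) with separating v vs vs!
  ... | ps , len , sep with collider sep a
  ... | x , x∈ , only-x with separate (All.lookup a∉ x∈)
  ... | p , a≢x = p ∷ ps , cong suc len , All.tabulate fresh ∷ separates-∷ sep
    where
    fresh : ∀ {d} → d ∈ v ∷ vs → signature (p ∷ ps) a ≢ signature (p ∷ ps) d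
    fresh d∈ eq with only-x d∈ (sym (proj₂ (∷-injective eq)))
    ... | refl = a≢x (proj₁ (∷-injective eq))

funToFin-cong : ∀ {f g : Fin m → Fin k} → (∀ i → f i ≡ g i) → funToFin f ≡ funToFin g
funToFin-cong {zero}  _   = refl
funToFin-cong {suc m} f≗g = cong₂ combine (f≗g zero) (funToFin-cong (f≗g ∘ suc))

-- Vertices are coded by the L binary digits of their index; "more than k" is witnessed
-- by k digit positions together with k + 1 distinct digit signatures that all occur.
module Threshold {I : Set} {n : ℕ} (L : ℕ) (n≤2^L : n ≤ 2 ^ L) where

  digit : Fin n → Fin L → Fin 2
  digit v = finToFun (inject≤ v n≤2^L)

  digits-differ : ∀ {u v} → u ≢ v → ∃ λ p → digit u p ≢ digit v p
  digits-differ {u} {v} u≢v = ¬∀⟶∃¬ L _ (λ p → digit u p Fin.≟ digit v p) λ same →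
    u≢v (inject≤-injective n≤2^L n≤2^L u v (begin
      inject≤ u n≤2^L                     ≡⟨ sym (funToFin-finToFin {L} {2} (inject≤ u n≤2^L)) ⟩
      funToFin (digit u)                  ≡⟨ funToFin-cong same ⟩
      funToFin (digit v)                  ≡⟨ funToFin-finToFin {L} {2} (inject≤ v n≤2^L) ⟩
      inject≤ v n≤2^L                     ∎))
    where open ≡-Reasoning

  open Separation Fin._≟_ digit digits-differ

  open import Data.List.Relation.Unary.Unique.DecPropositional (≡-dec (Fin._≟_ {2})) using (unique?)

  positionTuples : ℕ → List (List (Fin L))
  positionTuples k = tuples k (allFin L)

  signatureTuples : ℕ → List (List (List (Fin 2)))
  signatureTuples k = tuples (suc k) (tuples k (allFin 2))

  signatureSets : ℕ → List (List (List (Fin 2)))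
  signatureSets k = filter unique? (signatureTuples k)

  signature? : ∀ ps q v → Dec (signature ps v ≡ q)
  signature? ps q v = ≡-dec Fin._≟_ (signature ps v) q

  ∈-signatureSets⁻ : ∀ {k Q} → Q ∈ signatureSets k → length Q ≡ suc k × Unique Q
  ∈-signatureSets⁻ {k} Q∈ = Product.map₁ (tuples-length (suc k) {xs = tuples k (allFin 2)})
                                         (∈-filter⁻ unique? {xs = signatureTuples k} Q∈)

  realised : (Fin n → Formula I) → List (Fin L) → List (Fin 2) → Formula I
  realised b ps q = ⋁ b (filter (signature? ps q) (allFin n))

  moreThan : ℕ → (Fin n → Formula I) → Formula I
  moreThan k b = ⋁ (λ ps → ⋁ (⋀ (realised b ps)) (signatureSets k)) (positionTuples k)

  depth-moreThan : ∀ {b : Fin n → Formula I} → (∀ v → depthᶠ (b v) ≤ D) →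
                   depthᶠ (moreThan k b) ≤ 4 + D
  depth-moreThan {k = k} {b} h =
    depth-⋁ {f = λ ps → ⋁ (⋀ (realised b ps)) (signatureSets k)} {positionTuples k} λ ps →
    depth-⋁ {f = ⋀ (realised b ps)} {signatureSets k} λ Q →
    depth-⋀ {f = realised b ps} {Q} λ q →
    depth-⋁ {f = b} {filter (signature? ps q) (allFin n)} h

  fanIn-moreThan : ∀ {b : Fin n → Formula I} → (∀ v → fanIn (b v) ≤ F) →
                   n ≤ F → suc k ≤ F → L ^ k ≤ F → (2 ^ k) ^ suc k ≤ F → fanIn (moreThan k b) ≤ F
  fanIn-moreThan {F = F} {k = k} {b = b} h n≤F k<F L^k≤F signatures≤F =
    fanIn-⋁ {f = λ ps → ⋁ (⋀ (realised b ps)) (signatureSets k)} {xs = positionTuples k}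
      (subst (_≤ F) (sym length-positions) L^k≤F)
    λ {ps} _ → fanIn-⋁ {f = ⋀ (realised b ps)} {xs = signatureSets k}
      (≤-trans (length-filter unique? (signatureTuples k))
               (subst (_≤ F) (sym length-signatures) signatures≤F))
    λ {Q} Q∈ → fanIn-⋀ {f = realised b ps} {xs = Q}
      (subst (_≤ F) (sym (proj₁ (∈-signatureSets⁻ {k} Q∈))) k<F)
    λ {q} _ → fanIn-⋁ {f = b} {xs = filter (signature? ps q) (allFin n)}
      (≤-trans (length-filter (signature? ps q) (allFin n))
               (subst (_≤ F) (sym (length-tabulate id)) n≤F))
    λ _ → h _
    where
    length-positions : length (positionTuples k) ≡ L ^ k
    length-positions = trans (length-tuples k (allFin L)) (cong (_^ k) (length-tabulate id))
    length-signatures : length (signatureTuples k) ≡ (2 ^ k) ^ suc k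
    length-signatures = trans (length-tuples (suc k) (tuples k (allFin 2)))
                              (cong (_^ suc k) (length-tuples k (allFin 2)))

  module _ {w : I → Bool} {b : Fin n → Formula I} {P : Fin n → Set} (P? : ∀ v → Dec (P v))
           (defines : ∀ v → w ⊨ b v ⇔ P v) where

    ⊨-realised : ∀ {ps q} → w ⊨ realised b ps q ⇔ ∃ λ v → signature ps v ≡ q × P v
    ⊨-realised {ps} {q} = mk⇔
      (λ h → let v , v∈ , bv = find (to ⊨-⋁ h) in
             v , proj₂ (∈-filter⁻ (signature? ps q) {xs = allFin n} v∈) , to (defines v) bv)
      (λ (v , eq , pv) → from ⊨-⋁
         (lose (∈-filter⁺ (signature? ps q) {xs = allFin n} (∈-allFin v) eq) (from (defines v) pv)))

    moreThan-sound : w ⊨ moreThan k b → suc k ≤ ∣ subsetOf P? ∣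
    moreThan-sound {k} h with find (to ⊨-⋁ h)
    ... | ps , _ , h′ with find (to ⊨-⋁ h′)
    ... | Q , Q∈ , h″ = subst (_≤ ∣ subsetOf P? ∣) (proj₁ (∈-signatureSets⁻ {k} Q∈))
                              (distinct-images-≤ (signature ps) (proj₂ (∈-signatureSets⁻ {k} Q∈))
                                                 (All.map occurs (to ⊨-⋀ h″)))
      where
      occurs : ∀ {q} → w ⊨ realised b ps q → ∃ λ v → v ∈ₛ subsetOf P? × signature ps v ≡ q
      occurs r = let v , eq , pv = to ⊨-realised r in v , from (∈-subsetOf P?) pv , eq

    moreThan-complete : suc k ≤ ∣ subsetOf P? ∣ → w ⊨ moreThan k b
    moreThan-complete k<∣S∣ with distinct-members (subsetOf P?) k<∣S∣
    ... | v ∷ vs , vs! , vs⊆S , refl with separating v vs vs!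
    ... | ps , len , separated =
      from ⊨-⋁ (lose ps∈ occurring)
      where
      Q = map (signature ps) (v ∷ vs)
      ps∈ : ps ∈ positionTuples (length vs)
      ps∈ = subst (λ m → ps ∈ tuples m (allFin L)) len (∈-tuples (All.universal ∈-allFin ps))
      signature∈ : ∀ u → signature ps u ∈ tuples (length vs) (allFin 2)
      signature∈ u = subst (λ m → signature ps u ∈ tuples m (allFin 2))
                           (trans (length-map _ ps) len)
                           (∈-tuples (All.universal ∈-allFin _))
      Q∈ : Q ∈ signatureSets (length vs)
      Q∈ = ∈-filter⁺ unique? (subst (λ m → Q ∈ tuples m (tuples (length vs) (allFin 2)))
                                    (length-map (signature ps) (v ∷ vs))
                                    (∈-tuples (All.map⁺ (All.universal signature∈ (v ∷ vs)))))
                             (AllPairs.map⁺ separated)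
      realise : ∀ {u} → u ∈ v ∷ vs → w ⊨ realised b ps (signature ps u)
      realise u∈ = from ⊨-realised (_ , refl , to (∈-subsetOf P?) (All.lookup vs⊆S u∈))
      occurring : w ⊨ ⋁ (⋀ (realised b ps)) (signatureSets (length vs))
      occurring = from ⊨-⋁ (lose Q∈ (from ⊨-⋀ (All.map⁺ (All.tabulate realise))))

    ⊨-moreThan : w ⊨ moreThan k b ⇔ suc k ≤ ∣ subsetOf P? ∣
    ⊨-moreThan = mk⇔ moreThan-sound moreThan-complete

fanInFactor : ℕ → ℕ
fanInFactor k = 3 + k + k ^ k * 2 + (2 ^ k) ^ suc k

module DeletionFormula (ψ : QF) (n : ℕ) where

  open Threshold {Fin n × Fin n} (lg n) (proj₁ (lg-bounds n))

  walkφ : ℕ → Fin n → Fin n → Formula (Fin n × Fin n)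
  walkφ zero    x y = lit (does (x Fin.≟ y))
  walkφ (suc m) x y = ⋁ (λ z → qfFormula ψ x z ∧ᶠ walkφ m z y) (allFin n)

  walk≤2φ : Fin n → Fin n → Formula (Fin n × Fin n)
  walk≤2φ x y = ⋁ (λ m → walkφ (toℕ m) x y) (allFin 3)

  onShortCycleφ nearφ farφ : Fin n → Formula (Fin n × Fin n)
  onShortCycleφ x = walkφ 2 x x ∨ᶠ walkφ 4 x x
  nearφ x = ⋁ (λ c → onShortCycleφ c ∧ᶠ walk≤2φ x c) (allFin n)
  farφ x = neg (nearφ x)

  deletionφ : ℕ → Formula (Fin n × Fin n)
  deletionφ k = ⋁ nearφ (allFin n) ∧ᶠ neg (moreThan k farφ)

  depth-walkφ : ∀ m {x y} → depthᶠ (walkφ m x y) ≤ m * 2 + qfDepth ψ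
  depth-walkφ zero            = z≤n
  depth-walkφ (suc m) {x} {y} =
    depth-⋁ {f = λ z → qfFormula ψ x z ∧ᶠ walkφ m z y} {allFin n} λ z →
    depth-∧ᶠ (≤-trans (depth-qfFormula ψ x z) (m≤n+m (qfDepth ψ) (m * 2))) (depth-walkφ m)

  depth-walkφ-≤4 : ∀ {m x y} → m ≤ 4 → depthᶠ (walkφ m x y) ≤ 8 + qfDepth ψ
  depth-walkφ-≤4 {m} m≤4 = ≤-trans (depth-walkφ m) (+-monoˡ-≤ (qfDepth ψ) (*-monoˡ-≤ 2 m≤4))

  depth-walk≤2φ : ∀ {x y} → depthᶠ (walk≤2φ x y) ≤ 9 + qfDepth ψ
  depth-walk≤2φ {x} {y} = depth-⋁ {f = λ m → walkφ (toℕ m) x y} {allFin 3} λ m →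
    depth-walkφ-≤4 (≤-trans (<⇒≤ (toℕ<n m)) (n≤1+n 3))

  depth-onShortCycleφ : ∀ {x} → depthᶠ (onShortCycleφ x) ≤ 9 + qfDepth ψ
  depth-onShortCycleφ {x} =
    depth-∨ᶠ {φ = walkφ 2 x x} {walkφ 4 x x}
             (depth-walkφ-≤4 (s≤s (s≤s z≤n))) (depth-walkφ-≤4 ≤-refl)

  depth-nearφ : ∀ {x} → depthᶠ (nearφ x) ≤ 11 + qfDepth ψ
  depth-nearφ {x} = depth-⋁ {f = λ c → onShortCycleφ c ∧ᶠ walk≤2φ x c} {allFin n} λ c →
    depth-∧ᶠ {φ = onShortCycleφ c} {walk≤2φ x c} depth-onShortCycleφ depth-walk≤2φ

  depth-deletionφ : ∀ k → depthᶠ (deletionφ k) ≤ 18 + qfDepth ψ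
  depth-deletionφ k = depth-∧ᶠ {φ = ⋁ nearφ (allFin n)} {neg (moreThan k farφ)}
    (≤-trans (depth-⋁ {f = nearφ} {allFin n} λ _ → depth-nearφ) (m≤n+m (12 + qfDepth ψ) 5))
    (s≤s (depth-moreThan {k = k} {farφ} λ _ → s≤s depth-nearφ))

  module _ {F : ℕ} (3≤F : 3 ≤ F) (n≤F : n ≤ F) where

    2≤F : 2 ≤ F
    2≤F = ≤-trans (n≤1+n 2) 3≤F

    allFin≤F : length (allFin n) ≤ F
    allFin≤F = subst (_≤ F) (sym (length-tabulate id)) n≤F

    fanIn-walkφ : ∀ m {x y} → fanIn (walkφ m x y) ≤ F
    fanIn-walkφ zero            = z≤n
    fanIn-walkφ (suc m) {x} {y} =
      fanIn-⋁ {f = λ z → qfFormula ψ x z ∧ᶠ walkφ m z y} {allFin n} allFin≤F λ {z} _ →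
      fanIn-∧ᶠ {φ = qfFormula ψ x z} {walkφ m z y} 2≤F
               (≤-trans (fanIn-qfFormula ψ x z) 2≤F) (fanIn-walkφ m)

    fanIn-nearφ : ∀ {x} → fanIn (nearφ x) ≤ F
    fanIn-nearφ {x} =
      fanIn-⋁ {f = λ c → onShortCycleφ c ∧ᶠ walk≤2φ x c} {allFin n} allFin≤F λ {c} _ →
      fanIn-∧ᶠ {φ = onShortCycleφ c} {walk≤2φ x c} 2≤F
        (fanIn-∨ᶠ {φ = walkφ 2 c c} {walkφ 4 c c} 2≤F (fanIn-walkφ 2) (fanIn-walkφ 4))
        (fanIn-⋁ {f = λ m → walkφ (toℕ m) x c} {allFin 3} 3≤F λ {m} _ → fanIn-walkφ (toℕ m))

    fanIn-farφ : ∀ {x} → fanIn (farφ x) ≤ F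
    fanIn-farφ = ⊔-lub (≤-trans (s≤s z≤n) 2≤F) fanIn-nearφ

  fanIn-deletionφ : ∀ k → fanIn (deletionφ k) ≤ fanInFactor k * suc n
  fanIn-deletionφ k = fanIn-∧ᶠ {φ = ⋁ nearφ (allFin n)} {neg (moreThan k farφ)} (2≤F 3≤F n≤F)
    (fanIn-⋁ {f = nearφ} {allFin n} (allFin≤F 3≤F n≤F) λ _ → fanIn-nearφ 3≤F n≤F)
    (⊔-lub (≤-trans (s≤s z≤n) (2≤F 3≤F n≤F))
           (fanIn-moreThan {k = k} {farφ} (λ _ → fanIn-farφ 3≤F n≤F)
                           n≤F (scale 1+k≤) L^k≤F (scale signatures≤)))
    where
    bound = fanInFactor k * suc n
    scale : ∀ {a} → a ≤ fanInFactor k → a ≤ bound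
    scale a≤ = ≤-trans a≤ (m≤m*n (fanInFactor k) (suc n))
    3+k≤ : 3 + k ≤ fanInFactor k
    3+k≤ = ≤-trans (m≤m+n (3 + k) (k ^ k * 2)) (m≤m+n (3 + k + k ^ k * 2) ((2 ^ k) ^ suc k))
    3≤F : 3 ≤ bound
    3≤F = scale (≤-trans (m≤m+n 3 k) 3+k≤)
    1+k≤ : suc k ≤ fanInFactor k
    1+k≤ = ≤-trans (m≤n+m (suc k) 2) 3+k≤
    k^k*2≤ : k ^ k * 2 ≤ fanInFactor k
    k^k*2≤ = ≤-trans (m≤n+m (k ^ k * 2) (3 + k)) (m≤m+n (3 + k + k ^ k * 2) ((2 ^ k) ^ suc k))
    signatures≤ : (2 ^ k) ^ suc k ≤ fanInFactor k
    signatures≤ = m≤n+m ((2 ^ k) ^ suc k) (3 + k + k ^ k * 2)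
    n≤F : n ≤ bound
    n≤F = ≤-trans (n≤1+n n) (m≤n*m (suc n) (fanInFactor k))
    2^lg≤ : 2 ^ lg n ≤ 2 * suc n
    2^lg≤ = ≤-trans (proj₂ (lg-bounds n)) (s≤s (+-monoʳ-≤ n n≤1+n+0))
      where
      n≤1+n+0 : n ≤ suc n + 0
      n≤1+n+0 = ≤-trans (n≤1+n n) (≤-reflexive (sym (+-identityʳ (suc n))))
    L^k≤F : lg n ^ k ≤ bound
    L^k≤F = begin
      lg n ^ k             ≤⟨ n^k≤k^k*2^n (lg n) k ⟩
      k ^ k * 2 ^ lg n     ≤⟨ *-monoʳ-≤ (k ^ k) 2^lg≤ ⟩
      k ^ k * (2 * suc n)  ≡⟨ sym (*-assoc (k ^ k) 2 (suc n)) ⟩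
      k ^ k * 2 * suc n    ≤⟨ *-monoˡ-≤ (suc n) k^k*2≤ ⟩
      bound                ∎
      where open ≤-Reasoning

  module _ (G : Graph n) where

    open ShortCycles G ψ

    ⊨-qfFormula : ∀ {x y} → adjacency G ⊨ qfFormula ψ x y ⇔ x ↝ y
    ⊨-qfFormula {x} {y} = subst (λ b → T b ⇔ x ↝ y) (sym (eval-qfFormula G ψ x y)) T-≡ ⇔-∘ ⊨⇔T

    ⊨-walkφ : ∀ m {x y} → adjacency G ⊨ walkφ m x y ⇔ Walk m x y
    ⊨-walkφ zero    {x} {y} = does⇔ (x Fin.≟ y) ⇔-∘ (T-≡ ⇔-∘ ⊨⇔T)
    ⊨-walkφ (suc m)         = ∃-⇔ ((⊨-qfFormula ×-⇔ ⊨-walkφ m) ⇔-∘ ⊨-∧ᶠ) ⇔-∘ ⊨-⋁-allFin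

    ⊨-onShortCycleφ : ∀ {x} → adjacency G ⊨ onShortCycleφ x ⇔ OnShortCycle x
    ⊨-onShortCycleφ = (⊨-walkφ 2 ⊎-⇔ ⊨-walkφ 4) ⇔-∘ ⊨-∨ᶠ

    ⊨-walk≤2φ : ∀ {x y} → adjacency G ⊨ walk≤2φ x y ⇔ ∃ λ (m : Fin 3) → Walk (toℕ m) x y
    ⊨-walk≤2φ = ∃-⇔ (⊨-walkφ _) ⇔-∘ ⊨-⋁-allFin

    ⊨-nearφ : ∀ {x} → adjacency G ⊨ nearφ x ⇔ NearShortCycle x
    ⊨-nearφ = ∃-⇔ ((⊨-onShortCycleφ ×-⇔ ⊨-walk≤2φ) ⇔-∘ ⊨-∧ᶠ) ⇔-∘ ⊨-⋁-allFin

    ⊨-farφ : ∀ {x} → adjacency G ⊨ farφ x ⇔ (¬ NearShortCycle x)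
    ⊨-farφ = ¬-⇔ ⊨-nearφ ⇔-∘ ⊨-neg

    ⊨-deletionφ : ∀ k → adjacency G ⊨ deletionφ k ⇔ vd-ae ψ n G k
    ⊨-deletionφ k =
      ⇔-sym vd-ae⇔∃near×∣far∣≤k ⇔-∘ ((⊨-someNear ×-⇔ ⊨-fewFar) ⇔-∘ ⊨-∧ᶠ)
      where
      ⊨-someNear : adjacency G ⊨ ⋁ nearφ (allFin n) ⇔ ∃ NearShortCycle
      ⊨-someNear = ∃-⇔ ⊨-nearφ ⇔-∘ ⊨-⋁-allFin
      ⊨-fewFar : adjacency G ⊨ neg (moreThan k farφ) ⇔ ∣ far ∣ ≤ k
      ⊨-fewFar = mk⇔ ≮⇒≥ ≤⇒≯ ⇔-∘ (¬-⇔ (⊨-moreThan {b = farφ} (¬? ∘ near?) (λ _ → ⊨-farφ))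
                                      ⇔-∘ ⊨-neg)

lemma4p3 : (ψ : QF) → ParaAC0 (vd-ae ψ)
lemma4p3 ψ = paraAC0-fromFormulas deletionφ fanInFactor (18 + qfDepth ψ)
  fanIn-deletionφ depth-deletionφ (λ n k G → ⊨-deletionφ n G k)
  where open DeletionFormula ψ
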